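{- Let $v>k>i\ge 0$ be integers with $v\ge 2k$ and $(v,k,i)\neq(2k,k,0)$, let $X=J(v,k,i)$ and $\Delta=v-2k+2i$, and assume the girth of $X$ is $4$. Let $r=\left\lceil\frac{k-i}{\Delta}\right\rceil$. Let $A,B$ be vertices of $X$ and $x=|A\cap B|$. Then: (i) if $r$ is odd and $x\in\{\lfloor\frac{k+i-\Delta}{2}\rfloor,\lceil\frac{k+i-\Delta}{2}\rceil\}$, then $\mathrm{dist}(A,B)=r$; (ii) if $r$ is even and $x\in\{\lfloor\frac{k+i}{2}\rfloor,\lceil\frac{k+i}{2}\rceil\}$, then $\mathrm{dist}(A,B)=r$.
   Context: For integers $v>k>i\ge 0$, the generalized Johnson graph $J(v,k,i)$ is the simple undirected graph whose vertices are the $k$-element subsets of a fixed $v$-element set, two vertices $A,B$ being adjacent iff $|A\cap B|=i$. The girth is the length of a shortest cycle; $\mathrm{dist}$ denotes graph distance. -}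

module Defs where

open import Data.Nat as ℕ using (ℕ; zero; suc; _+_; _*_; _∸_; _≤_; _<_; _/_)
open import Data.Integer as ℤ using (ℤ; _/ℕ_)
open import Data.Fin using (Fin)
open import Data.Fin.Subset using (Subset; _∩_; ∣_∣)
open import Data.List using (List; []; _∷_; length)
open import Data.List.Relation.Unary.Unique.Propositional using (Unique)
open import Data.Product using (Σ; _×_; _,_; ∃)
open import Data.Empty using (⊥)
open import Relation.Binary.PropositionalEquality using (_≡_)

JVertex : ℕ → ℕ → Set
JVertex v k = Σ (Subset v) (λ A → ∣ A ∣ ≡ k)

JAdj : (v k i : ℕ) → JVertex v k → JVertex v k → Set
JAdj v k i (A , _) (B , _) = ∣ A ∩ B ∣ ≡ i

module _ {V : Set} (Adj : V → V → Set) where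

  data Walk : V → V → ℕ → Set where
    here  : ∀ {a} → Walk a a 0
    step  : ∀ {a b c n} → Adj a b → Walk b c n → Walk a c (suc n)

  Dist : V → V → ℕ → Set
  Dist a b d = Walk a b d × (∀ m → m < d → Walk a b m → ⊥)

  CycleAdj : List V → Set
  CycleAdj [] = ⊥
  CycleAdj (x ∷ xs) = ClosedFrom x x xs
    where
      ClosedFrom : V → V → List V → Set
      ClosedFrom first last [] = Adj last first
      ClosedFrom first last (y ∷ ys) = Adj last y × ClosedFrom first y ys

  IsCycle : List V → Set
  IsCycle c = 3 ≤ length c × Unique c × CycleAdj c

  Girth : ℕ → Set
  Girth g = (∃ λ c → IsCycle c × length c ≡ g)
          × (∀ c → IsCycle c → g ≤ length c)

-- ⌈ a / b ⌉ for natural numbers (b > 0; defined as 0 when b = 0, never used then).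
ceilDiv : ℕ → ℕ → ℕ
ceilDiv a zero = 0
ceilDiv a (suc b) = (a + b) / suc b

-- ⌊ m / 2 ⌋ and ⌈ m / 2 ⌉ for integers (_/ℕ_ on ℤ is floor division).
floorHalf : ℤ → ℤ
floorHalf m = m /ℕ 2

ceilHalf : ℤ → ℤ
ceilHalf m = (m ℤ.+ ℤ.+ 1) /ℕ 2

-- Fix B and write x(A) = |A ∩ B|. Counting how two adjacent vertices A, C meet B gives
-- k + i ≤ Δ + x(A) + x(C) and x(A) + x(C) ≤ k + i. Along a walk ending at B this yields
-- k ≤ x + jΔ after 2j steps and x ≤ i + jΔ after 2j + 1 steps; for x near (k + i)/2
-- (r even) or (k + i − Δ)/2 (r odd) both fail at the lengths r − 2 and r − 1, and as walks
-- can be lengthened by 2 no walk shorter than r exists. Conversely, a neighbour of A with a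
-- prescribed x can be assembled cell by cell from A ∩ B, A ∖ B, B ∖ A and the complement of
-- A ∪ B; alternating between x = i + tΔ and x = k − (t + 1)Δ this gives a walk of length
-- exactly r. The girth hypothesis only serves to exclude k ≤ Δ + i, where every edge lies on
-- a triangle.
module Submission where

open import Data.Bool using (Bool; true; false; _∧_)
open import Data.Empty using (⊥; ⊥-elim)
open import Data.Fin.Subset using (Subset; _∩_; ∁; ∣_∣)
open import Data.Fin.Subset.Properties using (∩-comm; ∩-idem)
open import Data.Integer using (+_; _-_)
open import Data.Integer.Properties using ([+m]-[+n]≡m⊖n; ⊖-≥; +-injective)
open import Data.List using (List; []; _∷_; length)
import Data.List.Relation.Unary.All as All
import Data.List.Relation.Unary.AllPairs as AllPairs
open import Data.Nat using (ℕ; zero; suc; _+_; _*_; _∸_; _≤_; _<_; _%_; _/_; z≤n; s≤s)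
open import Data.Nat.DivMod using (m≡m%n+[m/n]*n; m%n<n; m/n*n≤m)
open import Data.Nat.Properties
open import Algebra.Properties.CommutativeSemigroup +-commutativeSemigroup using (interchange; xy∙z≈xz∙y)
open import Data.Nat.Tactic.RingSolver using (solve; solve-∀)
open import Data.Product using (Σ; _×_; _,_; proj₁; proj₂)
open import Data.Sum using (_⊎_; inj₁; inj₂)
import Data.Sum
open import Function using (_∘_)
open import Relation.Binary.PropositionalEquality
open import Relation.Nullary using (¬_)

open import Defs

infixr 5 _⊕_
_⊕_ : ∀ {a b c d} → a ≤ b → c ≤ d → a + c ≤ b + d
_⊕_ = +-mono-≤

-- Linear facts are derived by adding up hypotheses and cancelling a common summand z;
-- the two rearrangements are ring identities.
≤-by-cancel : ∀ {a b l r} w z → l ≤ r → l ≡ a + w + z → r ≡ b + z → a ≤ b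
≤-by-cancel {a} {b} w z l≤r refl refl = m+n≤o⇒m≤o a (+-cancelʳ-≤ z (a + w) b l≤r)

≤-absurd : ∀ {l r} → l ≤ r → l ≡ suc r → ⊥
≤-absurd l≤r refl = 1+n≰n l≤r

half-≤ : ∀ {m n} → m + m ≤ suc (n + n) → m ≤ n
half-≤ {zero} _ = z≤n
half-≤ {suc m} {zero} (s≤s h) with () ← subst (_≤ 0) (+-suc m m) h
half-≤ {suc m} {suc n} (s≤s h) =
  s≤s (half-≤ (≤-pred (subst₂ _≤_ (+-suc m m) (cong suc (+-suc n n)) h)))

-- Vec's constructors stay local: list literals handed to the ring solver must not be ambiguous.
module _ where
  open import Data.Vec using ([]; _∷_)

  𝕀 : Bool → ℕ
  𝕀 true  = 1
  𝕀 false = 0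

  ∣x∷p∣≡𝕀x+∣p∣ : ∀ {n} x (p : Subset n) → ∣ x ∷ p ∣ ≡ 𝕀 x + ∣ p ∣
  ∣x∷p∣≡𝕀x+∣p∣ true  p = refl
  ∣x∷p∣≡𝕀x+∣p∣ false p = refl

  ∣p∩r∣+∣q∩r∣≤∣r∣+∣p∩q∣ : ∀ {n} (p q r : Subset n) → ∣ p ∩ r ∣ + ∣ q ∩ r ∣ ≤ ∣ r ∣ + ∣ p ∩ q ∣
  ∣p∩r∣+∣q∩r∣≤∣r∣+∣p∩q∣ [] [] [] = z≤n
  ∣p∩r∣+∣q∩r∣≤∣r∣+∣p∩q∣ (x ∷ p) (y ∷ q) (z ∷ r)
    rewrite ∣x∷p∣≡𝕀x+∣p∣ (x ∧ z) (p ∩ r) | ∣x∷p∣≡𝕀x+∣p∣ (y ∧ z) (q ∩ r)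
          | ∣x∷p∣≡𝕀x+∣p∣ z r | ∣x∷p∣≡𝕀x+∣p∣ (x ∧ y) (p ∩ q)
    = subst₂ _≤_ (interchange (𝕀 (x ∧ z)) (𝕀 (y ∧ z)) (∣ p ∩ r ∣) (∣ q ∩ r ∣))
                 (interchange (𝕀 z) (𝕀 (x ∧ y)) (∣ r ∣) (∣ p ∩ q ∣))
                 (pointwise x y z ⊕ ∣p∩r∣+∣q∩r∣≤∣r∣+∣p∩q∣ p q r)
    where
    pointwise : ∀ x y z → 𝕀 (x ∧ z) + 𝕀 (y ∧ z) ≤ 𝕀 z + 𝕀 (x ∧ y)
    pointwise true  true  true  = ≤ᵇ⇒≤ _ _ _
    pointwise true  true  false = ≤ᵇ⇒≤ _ _ _
    pointwise true  false true  = ≤ᵇ⇒≤ _ _ _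
    pointwise true  false false = ≤ᵇ⇒≤ _ _ _
    pointwise false true  true  = ≤ᵇ⇒≤ _ _ _
    pointwise false true  false = ≤ᵇ⇒≤ _ _ _
    pointwise false false true  = ≤ᵇ⇒≤ _ _ _
    pointwise false false false = ≤ᵇ⇒≤ _ _ _

  ∣p∣+∣q∣+∣r∣≤n+∣p∩q∣+∣p∩r∣+∣q∩r∣ : ∀ {n} (p q r : Subset n) →
    ∣ p ∣ + ∣ q ∣ + ∣ r ∣ ≤ n + ∣ p ∩ q ∣ + ∣ p ∩ r ∣ + ∣ q ∩ r ∣
  ∣p∣+∣q∣+∣r∣≤n+∣p∩q∣+∣p∩r∣+∣q∩r∣ [] [] [] = z≤n
  ∣p∣+∣q∣+∣r∣≤n+∣p∩q∣+∣p∩r∣+∣q∩r∣ {suc n} (x ∷ p) (y ∷ q) (z ∷ r)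
    rewrite ∣x∷p∣≡𝕀x+∣p∣ x p | ∣x∷p∣≡𝕀x+∣p∣ y q | ∣x∷p∣≡𝕀x+∣p∣ z r
          | ∣x∷p∣≡𝕀x+∣p∣ (x ∧ y) (p ∩ q) | ∣x∷p∣≡𝕀x+∣p∣ (x ∧ z) (p ∩ r)
          | ∣x∷p∣≡𝕀x+∣p∣ (y ∧ z) (q ∩ r)
    = subst₂ _≤_ (regroup (𝕀 x) (𝕀 y) (𝕀 z) (∣ p ∣) (∣ q ∣) (∣ r ∣))
                 (regroup′ n (𝕀 (x ∧ y)) (𝕀 (x ∧ z)) (𝕀 (y ∧ z)) (∣ p ∩ q ∣) (∣ p ∩ r ∣) (∣ q ∩ r ∣))
                 (pointwise x y z ⊕ ∣p∣+∣q∣+∣r∣≤n+∣p∩q∣+∣p∩r∣+∣q∩r∣ p q r)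
    where
    regroup : ∀ a b c d e f → (a + b + c) + (d + e + f) ≡ (a + d) + (b + e) + (c + f)
    regroup = solve-∀
    regroup′ : ∀ n a b c d e f → (1 + a + b + c) + (n + d + e + f) ≡ suc n + (a + d) + (b + e) + (c + f)
    regroup′ = solve-∀
    pointwise : ∀ x y z → 𝕀 x + 𝕀 y + 𝕀 z ≤ 1 + 𝕀 (x ∧ y) + 𝕀 (x ∧ z) + 𝕀 (y ∧ z)
    pointwise true  true  true  = ≤ᵇ⇒≤ _ _ _
    pointwise true  true  false = ≤ᵇ⇒≤ _ _ _
    pointwise true  false true  = ≤ᵇ⇒≤ _ _ _
    pointwise true  false false = ≤ᵇ⇒≤ _ _ _
    pointwise false true  true  = ≤ᵇ⇒≤ _ _ _
    pointwise false true  false = ≤ᵇ⇒≤ _ _ _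
    pointwise false false true  = ≤ᵇ⇒≤ _ _ _
    pointwise false false false = ≤ᵇ⇒≤ _ _ _

  ∣p∩∁q∣+∣p∩q∣≡∣p∣ : ∀ {n} (p q : Subset n) → ∣ p ∩ ∁ q ∣ + ∣ p ∩ q ∣ ≡ ∣ p ∣
  ∣p∩∁q∣+∣p∩q∣≡∣p∣ [] [] = refl
  ∣p∩∁q∣+∣p∩q∣≡∣p∣ (true  ∷ p) (true  ∷ q) = trans (+-suc _ _) (cong suc (∣p∩∁q∣+∣p∩q∣≡∣p∣ p q))
  ∣p∩∁q∣+∣p∩q∣≡∣p∣ (true  ∷ p) (false ∷ q) = cong suc (∣p∩∁q∣+∣p∩q∣≡∣p∣ p q)
  ∣p∩∁q∣+∣p∩q∣≡∣p∣ (false ∷ p) (true  ∷ q) = ∣p∩∁q∣+∣p∩q∣≡∣p∣ p q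
  ∣p∩∁q∣+∣p∩q∣≡∣p∣ (false ∷ p) (false ∷ q) = ∣p∩∁q∣+∣p∩q∣≡∣p∣ p q

  ∣∁p∩q∣+∣p∩q∣≡∣q∣ : ∀ {n} (p q : Subset n) → ∣ ∁ p ∩ q ∣ + ∣ p ∩ q ∣ ≡ ∣ q ∣
  ∣∁p∩q∣+∣p∩q∣≡∣q∣ p q =
    trans (cong₂ _+_ (cong ∣_∣ (∩-comm (∁ p) q)) (cong ∣_∣ (∩-comm p q))) (∣p∩∁q∣+∣p∩q∣≡∣p∣ q p)

  ∣∁p∩∁q∣+∣p∣+∣q∣≡n+∣p∩q∣ : ∀ {n} (p q : Subset n) → ∣ ∁ p ∩ ∁ q ∣ + ∣ p ∣ + ∣ q ∣ ≡ n + ∣ p ∩ q ∣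
  ∣∁p∩∁q∣+∣p∣+∣q∣≡n+∣p∩q∣ [] [] = refl
  ∣∁p∩∁q∣+∣p∣+∣q∣≡n+∣p∩q∣ {suc n} (true ∷ p) (true ∷ q) =
    trans (cong (_+ suc ∣ q ∣) (+-suc _ ∣ p ∣))
          (cong suc (trans (+-suc _ ∣ q ∣)
                           (trans (cong suc (∣∁p∩∁q∣+∣p∣+∣q∣≡n+∣p∩q∣ p q)) (sym (+-suc n _)))))
  ∣∁p∩∁q∣+∣p∣+∣q∣≡n+∣p∩q∣ (true ∷ p) (false ∷ q) =
    trans (cong (_+ ∣ q ∣) (+-suc _ ∣ p ∣)) (cong suc (∣∁p∩∁q∣+∣p∣+∣q∣≡n+∣p∩q∣ p q))
  ∣∁p∩∁q∣+∣p∣+∣q∣≡n+∣p∩q∣ (false ∷ p) (true ∷ q) =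
    trans (+-suc _ ∣ q ∣) (cong suc (∣∁p∩∁q∣+∣p∣+∣q∣≡n+∣p∩q∣ p q))
  ∣∁p∩∁q∣+∣p∣+∣q∣≡n+∣p∩q∣ (false ∷ p) (false ∷ q) = cong suc (∣∁p∩∁q∣+∣p∣+∣q∣≡n+∣p∩q∣ p q)

  subset-with-cell-counts : ∀ {n} (p q : Subset n) a b c d →
    a ≤ ∣ p ∩ q ∣ → b ≤ ∣ p ∩ ∁ q ∣ → c ≤ ∣ ∁ p ∩ q ∣ → d ≤ ∣ ∁ p ∩ ∁ q ∣ →
    Σ (Subset n) λ r → ∣ r ∣ ≡ a + b + c + d × ∣ p ∩ r ∣ ≡ a + b × ∣ r ∩ q ∣ ≡ a + c
  subset-with-cell-counts [] [] zero zero zero zero _ _ _ _ = [] , refl , refl , refl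
  subset-with-cell-counts (true ∷ p) (true ∷ q) zero b c d _ hb hc hd
    with subset-with-cell-counts p q 0 b c d z≤n hb hc hd
  ... | r , e₁ , e₂ , e₃ = false ∷ r , e₁ , e₂ , e₃
  subset-with-cell-counts (true ∷ p) (true ∷ q) (suc a) b c d (s≤s ha) hb hc hd
    with subset-with-cell-counts p q a b c d ha hb hc hd
  ... | r , e₁ , e₂ , e₃ = true ∷ r , cong suc e₁ , cong suc e₂ , cong suc e₃
  subset-with-cell-counts (true ∷ p) (false ∷ q) a zero c d ha _ hc hd
    with subset-with-cell-counts p q a 0 c d ha z≤n hc hd
  ... | r , e₁ , e₂ , e₃ = false ∷ r , e₁ , e₂ , e₃
  subset-with-cell-counts (true ∷ p) (false ∷ q) a (suc b) c d ha (s≤s hb) hc hd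
    with subset-with-cell-counts p q a b c d ha hb hc hd
  ... | r , e₁ , e₂ , e₃ =
    true ∷ r , trans (cong suc e₁) (sym (cong (λ t → t + c + d) (+-suc a b))) ,
    trans (cong suc e₂) (sym (+-suc a b)) , e₃
  subset-with-cell-counts (false ∷ p) (true ∷ q) a b zero d ha hb _ hd
    with subset-with-cell-counts p q a b 0 d ha hb z≤n hd
  ... | r , e₁ , e₂ , e₃ = false ∷ r , e₁ , e₂ , e₃
  subset-with-cell-counts (false ∷ p) (true ∷ q) a b (suc c) d ha hb (s≤s hc) hd
    with subset-with-cell-counts p q a b c d ha hb hc hd
  ... | r , e₁ , e₂ , e₃ =
    true ∷ r , trans (cong suc e₁) (sym (cong (_+ d) (+-suc (a + b) c))) , e₂ ,
    trans (cong suc e₃) (sym (+-suc a c))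
  subset-with-cell-counts (false ∷ p) (false ∷ q) a b c zero ha hb hc _
    with subset-with-cell-counts p q a b c 0 ha hb hc z≤n
  ... | r , e₁ , e₂ , e₃ = false ∷ r , e₁ , e₂ , e₃
  subset-with-cell-counts (false ∷ p) (false ∷ q) a b c (suc d) ha hb hc (s≤s hd)
    with subset-with-cell-counts p q a b c d ha hb hc hd
  ... | r , e₁ , e₂ , e₃ = true ∷ r , trans (cong suc e₁) (sym (+-suc (a + b + c) d)) , e₂ , e₃

module _ {V : Set} (Adj : V → V → Set)
         (adj-sym : ∀ a b → Adj a b → Adj b a) (neighbour : ∀ a → Σ V (Adj a)) where

  walk-+2 : ∀ {a b m} → Walk Adj a b m → Walk Adj a b (suc (suc m))
  walk-+2 {a} w with c , a~c ← neighbour a = step a~c (step (adj-sym a c a~c) w)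

  dist-from-missing-lengths : ∀ {a b n} → Walk Adj a b (suc (suc n)) →
    ¬ Walk Adj a b n → ¬ Walk Adj a b (suc n) → Dist Adj a b (suc (suc n))
  dist-from-missing-lengths {a} {b} {n} w ¬wₙ ¬wₙ₊₁ =
    w , λ m m<n+2 → shorter m (suc n ∸ m) (m+[n∸m]≡n (≤-pred m<n+2))
    where
    shorter : ∀ m g → m + g ≡ suc n → ¬ Walk Adj a b m
    shorter m zero e = ¬wₙ₊₁ ∘ subst (Walk Adj a b) (trans (sym (+-identityʳ m)) e)
    shorter m (suc zero) e = ¬wₙ ∘ subst (Walk Adj a b) (suc-injective (trans (+-comm 1 m) e))
    shorter m (suc (suc g)) e =
      shorter (suc (suc m)) g (trans (sym (trans (+-suc m (suc g)) (cong suc (+-suc m g)))) e) ∘ walk-+2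

n≡n%2+[n/2+n/2] : ∀ n → n ≡ n % 2 + (n / 2 + n / 2)
n≡n%2+[n/2+n/2] n =
  trans (m≡m%n+[m/n]*n n 2) (cong (_+_ (n % 2)) (trans (*-comm (n / 2) 2) (cong (_+_ (n / 2)) (+-identityʳ (n / 2)))))

even⇒≡half+half : ∀ n → n % 2 ≡ 0 → n ≡ n / 2 + n / 2
even⇒≡half+half n n%2≡0 = trans (n≡n%2+[n/2+n/2] n) (cong (_+ (n / 2 + n / 2)) n%2≡0)

odd⇒≡suc[half+half] : ∀ n → n % 2 ≡ 1 → n ≡ suc (n / 2 + n / 2)
odd⇒≡suc[half+half] n n%2≡1 = trans (n≡n%2+[n/2+n/2] n) (cong (_+ (n / 2 + n / 2)) n%2≡1)

n/2-bounds : ∀ n → n / 2 + n / 2 ≤ n × n ≤ suc (n / 2 + n / 2)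
n/2-bounds n = subst (n / 2 + n / 2 ≤_) (sym n≡) (m≤n+m (n / 2 + n / 2) (n % 2))
             , subst (_≤ suc (n / 2 + n / 2)) (sym n≡) (+-monoˡ-≤ (n / 2 + n / 2) (≤-pred (m%n<n n 2)))
  where
  n≡ : n ≡ n % 2 + (n / 2 + n / 2)
  n≡ = n≡n%2+[n/2+n/2] n

half-bounds : ∀ n {x} → (+ x ≡ floorHalf (+ n)) ⊎ (+ x ≡ ceilHalf (+ n)) → x + x ≤ suc n × n ≤ suc (x + x)
half-bounds n (inj₁ x≡) with refl ← +-injective x≡ =
  let lo , hi = n/2-bounds n in m≤n⇒m≤1+n lo , hi
half-bounds n {x} (inj₂ x≡) with refl ← +-injective x≡ =
  let lo , hi = n/2-bounds (n + 1) in subst (x + x ≤_) (+-comm n 1) lo , ≤-trans (m≤m+n n 1) hi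

shifted-half-bounds : ∀ {m d x} → d ≤ m → (+ x ≡ floorHalf (+ m - + d)) ⊎ (+ x ≡ ceilHalf (+ m - + d)) →
  x + x + d ≤ suc m × m ≤ suc (x + x + d)
shifted-half-bounds {m} {d} {x} d≤m x≈ =
  let lo , hi = half-bounds (m ∸ d) (Data.Sum.map (λ h → trans h (cong floorHalf m-d≡m∸d))
                                                  (λ h → trans h (cong ceilHalf m-d≡m∸d)) x≈)
  in subst (x + x + d ≤_) (cong suc m∸d+d≡m) (+-monoˡ-≤ d lo) , subst (_≤ suc (x + x + d)) m∸d+d≡m (+-monoˡ-≤ d hi)
  where
  m-d≡m∸d : + m - + d ≡ + (m ∸ d)
  m-d≡m∸d = trans ([+m]-[+n]≡m⊖n m d) (⊖-≥ d≤m)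
  m∸d+d≡m : m ∸ d + d ≡ m
  m∸d+d≡m = m∸n+n≡m d≤m

ceilDiv-lower : ∀ a D → 0 < D → a ≤ ceilDiv a D * D
ceilDiv-lower a (suc D) _ =
  ≤-by-cancel 0 D (≤-trans (≤-reflexive (m≡m%n+[m/n]*n (a + D) (suc D))) (+-monoˡ-≤ _ (≤-pred (m%n<n (a + D) (suc D)))))
    (sym (cong (_+ D) (+-identityʳ a))) (+-comm D _)

ceilDiv-upper : ∀ a D {r} → ceilDiv a D ≡ suc r → r * D < a
ceilDiv-upper a zero ()
ceilDiv-upper a (suc D) {r} ⌈a/D⌉≡1+r =
  ≤-by-cancel 0 D (subst (λ q → q * suc D ≤ a + D) ⌈a/D⌉≡1+r (m/n*n≤m (a + D) (suc D))) (solve (r ∷ D ∷ [])) refl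

0<v∸2k+2i : ∀ v k i → 2 * k ≤ v → ¬ (v ≡ 2 * k × i ≡ 0) → 0 < v ∸ 2 * k + 2 * i
0<v∸2k+2i v k (suc i) _ _ = ≤-trans (s≤s z≤n) (m≤n+m (2 * suc i) (v ∸ 2 * k))
0<v∸2k+2i v k zero 2k≤v not-[2k,0] with v ∸ 2 * k in v∸2k≡
... | zero  = ⊥-elim (not-[2k,0] (≤-antisym (m∸n≡0⇒m≤n v∸2k≡) 2k≤v , refl))
... | suc _ = s≤s z≤n

module JohnsonGraph (v k i Δ : ℕ) (Δ+2k≡v+2i : Δ + 2 * k ≡ v + 2 * i) (2i≤Δ : 2 * i ≤ Δ)
                    (1≤Δ : 1 ≤ Δ) (i<k : i < k) where

  V : Set
  V = JVertex v k

  Adj : V → V → Set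
  Adj = JAdj v k i

  i≤Δ : i ≤ Δ
  i≤Δ = ≤-trans (m≤m+n i (i + 0)) 2i≤Δ

  ∣A∩A∣≡k : (A : V) → ∣ proj₁ A ∩ proj₁ A ∣ ≡ k
  ∣A∩A∣≡k (A , ∣A∣≡k) = trans (cong ∣_∣ (∩-idem A)) ∣A∣≡k

  adj-sym : ∀ A C → Adj A C → Adj C A
  adj-sym (A , _) (C , _) A~C = trans (cong ∣_∣ (∩-comm C A)) A~C

  adj⇒≢ : ∀ {A C} → Adj A C → A ≢ C
  adj⇒≢ {A} A~A refl = <-irrefl (trans (sym A~A) (∣A∩A∣≡k A)) i<k

  complement-bound : ∀ {x y d} → y + k + k ≡ v + x → d + 2 * i ≤ Δ + x → d ≤ y
  complement-bound {x} {y} {d} e h = ≤-by-cancel 0 (2 * i + 2 * k) (h ⊕ ≤-refl {2 * k})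
    (solve (d ∷ i ∷ k ∷ [])) (begin
      Δ + x + 2 * k       ≡⟨ solve (Δ ∷ x ∷ k ∷ []) ⟩
      Δ + 2 * k + x       ≡⟨ cong (_+ x) Δ+2k≡v+2i ⟩
      v + 2 * i + x       ≡⟨ solve (v ∷ i ∷ x ∷ []) ⟩
      v + x + 2 * i       ≡⟨ cong (_+ 2 * i) e ⟨
      y + k + k + 2 * i   ≡⟨ solve (y ∷ k ∷ i ∷ []) ⟩
      y + (2 * i + 2 * k) ∎)
    where open ≡-Reasoning

  -- The neighbour C takes a, b, c and d elements from A ∩ B, A ∖ B, B ∖ A and ∁ (A ∪ B).
  neighbour-with-counts : ∀ (A B : V) {x} → ∣ proj₁ A ∩ proj₁ B ∣ ≡ x → ∀ a b c d →
    a ≤ x → b + x ≤ k → c + x ≤ k → d + 2 * i ≤ Δ + x → a + b ≡ i → c + d + i ≡ k →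
    Σ V λ C → Adj A C × ∣ proj₁ C ∩ proj₁ B ∣ ≡ a + c
  neighbour-with-counts (A , ∣A∣≡k) (B , ∣B∣≡k) {x} refl a b c d a≤ b≤ c≤ d≤ a+b≡i c+d+i≡k
    with C , ∣C∣≡ , ∣A∩C∣≡ , ∣C∩B∣≡ ←
           subset-with-cell-counts A B a b c d a≤
             (+-cancelʳ-≤ x b _ (subst (b + x ≤_) (sym (trans (∣p∩∁q∣+∣p∩q∣≡∣p∣ A B) ∣A∣≡k)) b≤))
             (+-cancelʳ-≤ x c _ (subst (c + x ≤_) (sym (trans (∣∁p∩q∣+∣p∩q∣≡∣q∣ A B) ∣B∣≡k)) c≤))
             (complement-bound (subst₂ (λ s t → _ + s + t ≡ v + x) ∣A∣≡k ∣B∣≡k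
                                       (∣∁p∩∁q∣+∣p∣+∣q∣≡n+∣p∩q∣ A B)) d≤)
    = (C , trans ∣C∣≡ (begin
          a + b + c + d     ≡⟨ solve (a ∷ b ∷ c ∷ d ∷ []) ⟩
          c + d + (a + b)   ≡⟨ cong (_+_ (c + d)) a+b≡i ⟩
          c + d + i         ≡⟨ c+d+i≡k ⟩
          k                 ∎))
      , trans ∣A∩C∣≡ a+b≡i , ∣C∩B∣≡
    where open ≡-Reasoning

  neighbour : (A : V) → Σ V (Adj A)
  neighbour A with m≤n⇒∃[o]m+o≡n (<⇒≤ i<k)
  ... | d , i+d≡k =
    let C , A~C , _ = neighbour-with-counts A A (∣A∩A∣≡k A) i 0 0 d (<⇒≤ i<k) ≤-refl ≤-refl d+2i≤Δ+k
                        (+-identityʳ i) (trans (+-comm d i) i+d≡k)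
    in C , A~C
    where
    d+2i≤Δ+k : d + 2 * i ≤ Δ + k
    d+2i≤Δ+k = begin
      d + 2 * i ≡⟨ solve (d ∷ i ∷ []) ⟩
      i + d + i ≡⟨ cong (_+ i) i+d≡k ⟩
      k + i     ≤⟨ +-monoʳ-≤ k i≤Δ ⟩
      k + Δ     ≡⟨ +-comm k Δ ⟩
      Δ + k     ∎
      where open ≤-Reasoning

  common-neighbour : k ≤ Δ + i → ∀ {A C} → Adj A C → Σ V λ D → Adj A D × Adj D C
  common-neighbour k≤Δ+i {A} {C} A~C with ≤-total (i + i) k
  ... | inj₁ 2i≤k with m≤n⇒∃[o]m+o≡n 2i≤k
  ...   | d , 2i+d≡k =
    neighbour-with-counts A C A~C 0 i i d z≤n 2i≤k 2i≤k d+2i≤Δ+i refl (trans (xy∙z≈xz∙y i d i) 2i+d≡k)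
    where
    d+2i≤Δ+i : d + 2 * i ≤ Δ + i
    d+2i≤Δ+i = begin
      d + 2 * i ≡⟨ solve (d ∷ i ∷ []) ⟩
      i + i + d ≡⟨ 2i+d≡k ⟩
      k         ≤⟨ k≤Δ+i ⟩
      Δ + i     ∎
      where open ≤-Reasoning
  common-neighbour k≤Δ+i {A} {C} A~C | inj₂ k≤2i with m≤n⇒∃[o]m+o≡n (<⇒≤ i<k)
  ... | b , i+b≡k with m≤n⇒∃[o]m+o≡n (+-cancelˡ-≤ i b i (subst (_≤ i + i) (sym i+b≡k) k≤2i))
  ... | a , b+a≡i =
    let D , A~D , ∣D∩C∣≡a+b = neighbour-with-counts A C A~C a b b 0
          (subst (a ≤_) b+a≡i (m≤n+m a b)) (≤-reflexive b+i≡k) (≤-reflexive b+i≡k)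
          (subst (_≤ Δ + i) (cong (_+_ i) (sym (+-identityʳ i))) (+-monoˡ-≤ i i≤Δ)) a+b≡i
          (trans (cong (_+ i) (+-identityʳ b)) b+i≡k)
    in D , A~D , trans ∣D∩C∣≡a+b a+b≡i
    where
    b+i≡k : b + i ≡ k
    b+i≡k = trans (+-comm b i) i+b≡k
    a+b≡i : a + b ≡ i
    a+b≡i = trans (+-comm a b) b+a≡i

  triangle : k ≤ Δ + i → V → Σ (List V) λ c → IsCycle Adj c × length c ≡ 3
  triangle k≤Δ+i A with C , A~C ← neighbour A
                    with D , A~D , D~C ← common-neighbour k≤Δ+i {A} {C} A~C =
    A ∷ C ∷ D ∷ [] ,
    (≤-refl , (adj⇒≢ {A} {C} A~C All.∷ adj⇒≢ {A} {D} A~D All.∷ All.[])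
                AllPairs.∷ (adj⇒≢ {C} {D} C~D All.∷ All.[]) AllPairs.∷ All.[] AllPairs.∷ AllPairs.[] ,
     A~C , C~D , adj-sym A D A~D) ,
    refl
    where
    C~D : Adj C D
    C~D = adj-sym D C D~C

  girth-4⇒Δ+i<k : Girth Adj 4 → V → Δ + i < k
  girth-4⇒Δ+i<k (_ , shortest) A = ≰⇒> λ k≤Δ+i →
    let c , cycle , length≡3 = triangle k≤Δ+i A in 1+n≰n (subst (4 ≤_) length≡3 (shortest c cycle))

  module Towards (B : V) where

    meet : V → ℕ
    meet A = ∣ proj₁ A ∩ proj₁ B ∣

    meet-sum-≤ : ∀ A C → Adj A C → meet A + meet C ≤ k + i
    meet-sum-≤ A C A~C = subst₂ (λ s t → meet A + meet C ≤ s + t) (proj₂ B) A~C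
                           (∣p∩r∣+∣q∩r∣≤∣r∣+∣p∩q∣ (proj₁ A) (proj₁ C) (proj₁ B))

    meet-sum-≥ : ∀ A C → Adj A C → k + i ≤ Δ + (meet A + meet C)
    meet-sum-≥ A C A~C = cancel-2k (subst₂ _≤_
      (cong₂ _+_ (cong₂ _+_ (proj₂ A) (proj₂ C)) (proj₂ B))
      (cong (λ t → v + t + meet A + meet C) A~C)
      (∣p∣+∣q∣+∣r∣≤n+∣p∩q∣+∣p∩r∣+∣q∩r∣ (proj₁ A) (proj₁ C) (proj₁ B)))
      where
      cancel-2k : ∀ {a c} → k + k + k ≤ v + i + a + c → k + i ≤ Δ + (a + c)
      cancel-2k {a} {c} h = ≤-by-cancel 0 (k + k) (h ⊕ ≤-refl {i}) (solve (k ∷ i ∷ [])) (begin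
        v + i + a + c + i    ≡⟨ solve (v ∷ i ∷ a ∷ c ∷ []) ⟩
        v + 2 * i + (a + c)  ≡⟨ cong (_+ (a + c)) Δ+2k≡v+2i ⟨
        Δ + 2 * k + (a + c)  ≡⟨ solve (Δ ∷ k ∷ a ∷ c ∷ []) ⟩
        Δ + (a + c) + (k + k) ∎)
        where open ≡-Reasoning

    even-walk-bound : ∀ j {A} → Walk Adj A B (j + j) → k ≤ meet A + j * Δ
    odd-walk-bound : ∀ j {A} → Walk Adj A B (suc (j + j)) → meet A ≤ i + j * Δ

    even-walk-bound zero here = ≤-reflexive (sym (trans (+-identityʳ (meet B)) (∣A∩A∣≡k B)))
    even-walk-bound (suc j) {A} (step {b = C} A~C w) =
      combine (meet-sum-≥ A C A~C) (odd-walk-bound j (subst (Walk Adj C B) (+-suc j j) w))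
      where
      combine : ∀ {a c} → k + i ≤ Δ + (a + c) → c ≤ i + j * Δ → k ≤ a + (Δ + j * Δ)
      combine {a} {c} h₁ h₂ = ≤-by-cancel 0 (i + c) (h₁ ⊕ h₂)
        (solve (k ∷ i ∷ c ∷ [])) (solve (a ∷ c ∷ Δ ∷ i ∷ j ∷ []))

    odd-walk-bound j {A} (step {b = C} A~C w) = combine (meet-sum-≤ A C A~C) (even-walk-bound j w)
      where
      combine : ∀ {a c} → a + c ≤ k + i → k ≤ c + j * Δ → a ≤ i + j * Δ
      combine {a} {c} h₁ h₂ = ≤-by-cancel 0 (c + k) (h₁ ⊕ h₂)
        (solve (a ∷ c ∷ k ∷ [])) (solve (k ∷ i ∷ c ∷ j ∷ Δ ∷ []))

    even-step : ∀ P A → P + 2 * i ≤ k → P + i + meet A ≤ k → k ≤ Δ + P + meet A →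
      Σ V λ E → Adj A E × meet E ≡ i + P
    even-step P A P+2i≤k h₂ h₃ with m≤n⇒∃[o]m+o≡n P+2i≤k
    ... | d , P+2i+d≡k =
      let E , A~E , meet-E≡ = neighbour-with-counts A B refl 0 i (P + i) d z≤n
                                (≤-trans (+-monoˡ-≤ (meet A) (m≤n+m i P)) h₂) h₂ (d-bound h₃) refl c+d+i≡k
      in E , A~E , trans meet-E≡ (+-comm P i)
      where
      c+d+i≡k : P + i + d + i ≡ k
      c+d+i≡k = begin
        P + i + d + i  ≡⟨ solve (P ∷ i ∷ d ∷ []) ⟩
        P + 2 * i + d  ≡⟨ P+2i+d≡k ⟩
        k              ∎
        where open ≡-Reasoning
      d-bound : ∀ {x} → k ≤ Δ + P + x → d + 2 * i ≤ Δ + x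
      d-bound {x} h = ≤-by-cancel 0 P h
        (trans (sym P+2i+d≡k) (solve (P ∷ i ∷ d ∷ []))) (solve (Δ ∷ P ∷ x ∷ []))

    odd-step-below : ∀ P A → Δ + P + i ≤ k → P + i ≤ meet A → meet A ≤ Δ + P →
      Σ V λ D → Adj A D × meet D + (Δ + P) ≡ k
    odd-step-below P A h lo x≤Δ+P
      with m≤n⇒∃[o]m+o≡n (m+n≤o⇒m≤o (Δ + P) h) | m≤n⇒∃[o]m+o≡n (≤-trans i≤Δ (m≤m+n Δ P))
    ... | c , Δ+P+c≡k | d , i+d≡Δ+P =
      let D , A~D , meet-D≡c = neighbour-with-counts A B refl 0 i c d z≤n
            (≤-trans (+-monoʳ-≤ i x≤Δ+P) (subst (_≤ k) (+-comm (Δ + P) i) h))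
            (subst (c + meet A ≤_) c+Δ+P≡k (+-monoʳ-≤ c x≤Δ+P))
            d+2i≤Δ+x refl c+d+i≡k
      in D , A~D , trans (cong (_+ (Δ + P)) meet-D≡c) c+Δ+P≡k
      where
      c+Δ+P≡k : c + (Δ + P) ≡ k
      c+Δ+P≡k = trans (+-comm c (Δ + P)) Δ+P+c≡k
      d+2i≤Δ+x : d + 2 * i ≤ Δ + meet A
      d+2i≤Δ+x = begin
        d + 2 * i    ≡⟨ solve (d ∷ i ∷ []) ⟩
        i + d + i    ≡⟨ cong (_+ i) i+d≡Δ+P ⟩
        Δ + P + i    ≡⟨ +-assoc Δ P i ⟩
        Δ + (P + i)  ≤⟨ +-monoʳ-≤ Δ lo ⟩
        Δ + meet A   ∎
        where open ≤-Reasoning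
      c+d+i≡k : c + d + i ≡ k
      c+d+i≡k = begin
        c + d + i    ≡⟨ solve (c ∷ d ∷ i ∷ []) ⟩
        c + (i + d)  ≡⟨ cong (_+_ c) i+d≡Δ+P ⟩
        c + (Δ + P)  ≡⟨ c+Δ+P≡k ⟩
        k            ∎
        where open ≡-Reasoning

    odd-step-above : ∀ P A → Δ + P + i ≤ k → meet A ≤ Δ + P + i → Δ + P ≤ meet A →
      Σ V λ D → Adj A D × meet D + (Δ + P) ≡ k
    odd-step-above P A h hi Δ+P≤x with m≤n⇒∃[o]m+o≡n Δ+P≤x
    ... | e , Δ+P+e≡x
      with m≤n⇒∃[o]m+o≡n (+-cancelˡ-≤ (Δ + P) e i (subst (_≤ Δ + P + i) (sym Δ+P+e≡x) hi))
         | m≤n⇒∃[o]m+o≡n (≤-trans hi h)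
         | m≤n⇒∃[o]m+o≡n (≤-trans i≤Δ (≤-trans (m≤m+n Δ P) Δ+P≤x))
    ... | b , e+b≡i | c , x+c≡k | d , i+d≡x =
      let D , A~D , meet-D≡e+c = neighbour-with-counts A B refl e b c d
            (subst (e ≤_) Δ+P+e≡x (m≤n+m e (Δ + P))) b+x≤k
            (≤-reflexive (trans (+-comm c (meet A)) x+c≡k)) d+2i≤Δ+x e+b≡i c+d+i≡k
      in D , A~D , complement-meet meet-D≡e+c
      where
      complement-meet : ∀ {m} → m ≡ e + c → m + (Δ + P) ≡ k
      complement-meet {m} refl = begin
        e + c + (Δ + P)   ≡⟨ solve (e ∷ c ∷ Δ ∷ P ∷ []) ⟩
        Δ + P + e + c     ≡⟨ cong (_+ c) Δ+P+e≡x ⟩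
        meet A + c        ≡⟨ x+c≡k ⟩
        k                 ∎
        where open ≡-Reasoning
      b+x≤k : b + meet A ≤ k
      b+x≤k = begin
        b + meet A         ≡⟨ cong (_+_ b) Δ+P+e≡x ⟨
        b + (Δ + P + e)    ≡⟨ solve (b ∷ Δ ∷ P ∷ e ∷ []) ⟩
        Δ + P + (e + b)    ≡⟨ cong (_+_ (Δ + P)) e+b≡i ⟩
        Δ + P + i          ≤⟨ h ⟩
        k                  ∎
        where open ≤-Reasoning
      d+2i≤Δ+x : d + 2 * i ≤ Δ + meet A
      d+2i≤Δ+x = begin
        d + 2 * i      ≡⟨ solve (d ∷ i ∷ []) ⟩
        i + d + i      ≡⟨ cong (_+ i) i+d≡x ⟩
        meet A + i     ≤⟨ +-monoʳ-≤ (meet A) i≤Δ ⟩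
        meet A + Δ     ≡⟨ +-comm (meet A) Δ ⟩
        Δ + meet A     ∎
        where open ≤-Reasoning
      c+d+i≡k : c + d + i ≡ k
      c+d+i≡k = begin
        c + d + i       ≡⟨ solve (c ∷ d ∷ i ∷ []) ⟩
        c + (i + d)     ≡⟨ cong (_+_ c) i+d≡x ⟩
        c + meet A      ≡⟨ +-comm c (meet A) ⟩
        meet A + c      ≡⟨ x+c≡k ⟩
        k               ∎
        where open ≡-Reasoning

    odd-step : ∀ P A → Δ + P + i ≤ k → P + i ≤ meet A → meet A ≤ Δ + P + i →
      Σ V λ D → Adj A D × meet D + (Δ + P) ≡ k
    odd-step P A h lo hi with ≤-total (meet A) (Δ + P)
    ... | inj₁ x≤Δ+P = odd-step-below P A h lo x≤Δ+P
    ... | inj₂ Δ+P≤x = odd-step-above P A h hi Δ+P≤x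

    odd-walk : ∀ t A → t * Δ + i ≤ k → meet A ≡ i + t * Δ → Walk Adj A B (suc (t + t))
    odd-walk-from-range : ∀ t A → Δ + t * Δ + i ≤ k → t * Δ + i ≤ meet A → meet A ≤ Δ + t * Δ + i →
      Walk Adj A B (suc (suc (suc (t + t))))
    even-walk : ∀ t A → t * Δ + 2 * i ≤ k → t * Δ + i + meet A ≤ k → k ≤ Δ + t * Δ + meet A →
      Walk Adj A B (suc (suc (t + t)))

    odd-walk zero A _ meet≡ = step (trans meet≡ (+-identityʳ i)) here
    odd-walk (suc t) A h meet≡ =
      subst (Walk Adj A B) (cong (suc ∘ suc) (sym (+-suc t t)))
        (odd-walk-from-range t A h
          (≤-by-cancel Δ 0 (≤-reflexive (sym meet≡)) (solve (i ∷ Δ ∷ t ∷ [])) (sym (+-identityʳ _)))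
          (≤-reflexive (trans meet≡ (solve (i ∷ Δ ∷ t ∷ [])))))

    odd-walk-from-range t A h lo hi with odd-step (t * Δ) A h lo hi
    ... | D , A~D , meet-D+Δ+P≡k =
      step A~D (even-walk t D tΔ+2i≤k (tΔ+i+m≤k meet-D+Δ+P≡k)
                             (≤-reflexive (trans (sym meet-D+Δ+P≡k) (+-comm (meet D) (Δ + t * Δ)))))
      where
      tΔ+2i≤k : t * Δ + 2 * i ≤ k
      tΔ+2i≤k = ≤-by-cancel 0 Δ (h ⊕ i≤Δ) (solve (Δ ∷ t ∷ i ∷ [])) refl
      tΔ+i+m≤k : ∀ {m} → m + (Δ + t * Δ) ≡ k → t * Δ + i + m ≤ k
      tΔ+i+m≤k {m} e = ≤-by-cancel 0 Δ (i≤Δ ⊕ ≤-reflexive e) (solve (i ∷ m ∷ Δ ∷ t ∷ [])) (+-comm Δ k)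

    even-walk t A h₁ h₂ h₃ with even-step (t * Δ) A h₁ h₂ h₃
    ... | E , A~E , meet-E≡ = step A~E (odd-walk t E (≤-trans (+-monoʳ-≤ (t * Δ) (m≤m+n i (i + 0))) h₁) meet-E≡)

    dist-even : ∀ J A → k ≤ suc (suc (J + J)) * Δ + i → suc (J + J) * Δ + i < k →
      meet A + meet A ≤ suc (k + i) → k + i ≤ suc (meet A + meet A) →
      Dist Adj A B (suc (suc (J + J)))
    dist-even J A k≤rΔ+i r′Δ+i<k x-upper x-lower =
      dist-from-missing-lengths Adj adj-sym neighbour
        (even-walk J A JΔ+2i≤k (JΔ+i+x≤k {meet A} x-upper) (k≤Δ+JΔ+x {meet A} x-lower))
        (no-even-walk {meet A} x-upper ∘ even-walk-bound J)
        (no-odd-walk {meet A} x-lower ∘ odd-walk-bound J)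
      where
      JΔ+2i≤k : J * Δ + 2 * i ≤ k
      JΔ+2i≤k = ≤-by-cancel (J * Δ + i + 1) Δ (2i≤Δ ⊕ r′Δ+i<k) (solve (i ∷ J ∷ Δ ∷ [])) (+-comm Δ k)
      JΔ+i+x≤k : ∀ {x} → x + x ≤ suc (k + i) → J * Δ + i + x ≤ k
      JΔ+i+x≤k {x} h = half-≤ (m≤n⇒m≤1+n (≤-by-cancel 0 (Δ + i + 1) (h ⊕ 2i≤Δ ⊕ r′Δ+i<k)
        (solve (x ∷ i ∷ J ∷ Δ ∷ [])) (solve (k ∷ i ∷ Δ ∷ []))))
      k≤Δ+JΔ+x : ∀ {x} → k + i ≤ suc (x + x) → k ≤ Δ + J * Δ + x
      k≤Δ+JΔ+x {x} h = half-≤ (≤-by-cancel 0 i (h ⊕ k≤rΔ+i)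
        (solve (k ∷ i ∷ [])) (solve (x ∷ J ∷ Δ ∷ i ∷ [])))
      no-even-walk : ∀ {x} → x + x ≤ suc (k + i) → ¬ (k ≤ x + J * Δ)
      no-even-walk {x} h h′ = ≤-absurd (h′ ⊕ h′ ⊕ h ⊕ r′Δ+i<k ⊕ 1≤Δ) (solve (k ∷ x ∷ J ∷ Δ ∷ i ∷ []))
      no-odd-walk : ∀ {x} → k + i ≤ suc (x + x) → ¬ (x ≤ i + J * Δ)
      no-odd-walk {x} h h′ = ≤-absurd (h′ ⊕ h′ ⊕ h ⊕ r′Δ+i<k ⊕ 1≤Δ) (solve (k ∷ x ∷ J ∷ Δ ∷ i ∷ []))

    dist-odd : ∀ J A → k ≤ suc (suc (suc (J + J))) * Δ + i → suc (suc (J + J)) * Δ + i < k →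
      meet A + meet A + Δ ≤ suc (k + i) → k + i ≤ suc (meet A + meet A + Δ) →
      Dist Adj A B (suc (suc (suc (J + J))))
    dist-odd J A k≤rΔ+i r′Δ+i<k x-upper x-lower =
      dist-from-missing-lengths Adj adj-sym neighbour
        (odd-walk-from-range J A Δ+JΔ+i≤k (JΔ+i≤x {meet A} x-lower) (x≤Δ+JΔ+i {meet A} x-upper))
        (no-odd-walk {meet A} x-lower ∘ odd-walk-bound J)
        (no-even-walk {meet A} x-upper ∘ even-walk-bound (suc J) ∘ subst (Walk Adj A B) (cong suc (sym (+-suc J J))))
      where
      Δ+JΔ+i≤k : Δ + J * Δ + i ≤ k
      Δ+JΔ+i≤k = ≤-by-cancel (Δ + J * Δ + 1) 0 r′Δ+i<k (solve (Δ ∷ J ∷ i ∷ [])) (sym (+-identityʳ k))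
      JΔ+i≤x : ∀ {x} → k + i ≤ suc (x + x + Δ) → J * Δ + i ≤ x
      JΔ+i≤x {x} h = half-≤ (m≤n⇒m≤1+n (≤-by-cancel Δ (Δ + 1 + k) (h ⊕ r′Δ+i<k)
        (solve (k ∷ i ∷ J ∷ Δ ∷ [])) (solve (x ∷ Δ ∷ k ∷ []))))
      x≤Δ+JΔ+i : ∀ {x} → x + x + Δ ≤ suc (k + i) → x ≤ Δ + J * Δ + i
      x≤Δ+JΔ+i {x} h = half-≤ (≤-by-cancel 0 (Δ + k) (h ⊕ k≤rΔ+i)
        (solve (x ∷ Δ ∷ k ∷ [])) (solve (k ∷ i ∷ J ∷ Δ ∷ [])))
      no-even-walk : ∀ {x} → x + x + Δ ≤ suc (k + i) → ¬ (k ≤ x + (Δ + J * Δ))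
      no-even-walk {x} h h′ = ≤-absurd (h′ ⊕ h′ ⊕ h ⊕ r′Δ+i<k ⊕ 1≤Δ) (solve (k ∷ x ∷ J ∷ Δ ∷ i ∷ []))
      no-odd-walk : ∀ {x} → k + i ≤ suc (x + x + Δ) → ¬ (x ≤ i + J * Δ)
      no-odd-walk {x} h h′ = ≤-absurd (h′ ⊕ h′ ⊕ h ⊕ r′Δ+i<k ⊕ 1≤Δ) (solve (k ∷ x ∷ J ∷ Δ ∷ i ∷ []))

    dist-when-even : ∀ A r → r % 2 ≡ 0 → k ≤ r * Δ + i → (∀ {r′} → r ≡ suc r′ → r′ * Δ + i < k) →
      meet A + meet A ≤ suc (k + i) → k + i ≤ suc (meet A + meet A) → Dist Adj A B r
    dist-when-even A r r%2≡0 k≤rΔ+i r′Δ+i<k x-upper x-lower = with-half (r / 2) (even⇒≡half+half r r%2≡0)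
      where
      with-half : ∀ J → r ≡ J + J → Dist Adj A B r
      with-half zero r≡0 = ⊥-elim (<⇒≱ i<k (subst (λ s → k ≤ s * Δ + i) r≡0 k≤rΔ+i))
      with-half (suc J) r≡J+J = subst (Dist Adj A B) (sym r≡2+2J)
        (dist-even J A (subst (λ s → k ≤ s * Δ + i) r≡2+2J k≤rΔ+i) (r′Δ+i<k r≡2+2J) x-upper x-lower)
        where
        r≡2+2J : r ≡ suc (suc (J + J))
        r≡2+2J = trans r≡J+J (cong suc (+-suc J J))

    dist-when-odd : ∀ A r → r % 2 ≡ 1 → Δ + i < k → k ≤ r * Δ + i → (∀ {r′} → r ≡ suc r′ → r′ * Δ + i < k) →
      meet A + meet A + Δ ≤ suc (k + i) → k + i ≤ suc (meet A + meet A + Δ) → Dist Adj A B r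
    dist-when-odd A r r%2≡1 Δ+i<k k≤rΔ+i r′Δ+i<k x-upper x-lower = with-half (r / 2) (odd⇒≡suc[half+half] r r%2≡1)
      where
      with-half : ∀ J → r ≡ suc (J + J) → Dist Adj A B r
      with-half zero r≡1 = ⊥-elim (<⇒≱ Δ+i<k (subst (λ s → k ≤ s + i) (+-identityʳ Δ)
                                                   (subst (λ s → k ≤ s * Δ + i) r≡1 k≤rΔ+i)))
      with-half (suc J) r≡1+J+J = subst (Dist Adj A B) (sym r≡3+2J)
        (dist-odd J A (subst (λ s → k ≤ s * Δ + i) r≡3+2J k≤rΔ+i) (r′Δ+i<k r≡3+2J) x-upper x-lower)
        where
        r≡3+2J : r ≡ suc (suc (suc (J + J)))
        r≡3+2J = trans r≡1+J+J (cong (suc ∘ suc) (+-suc J J))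

lemma5p2 : (v k i : ℕ) → i < k → k < v → 2 * k ≤ v
    → ¬ (v ≡ 2 * k × i ≡ 0)
    → Girth (JAdj v k i) 4
    → (A B : JVertex v k)
    → let Δ = v ∸ 2 * k + 2 * i
          r = ceilDiv (k ∸ i) Δ
          x = ∣ proj₁ A ∩ proj₁ B ∣
      in ((r % 2 ≡ 1)
           → ((+ x ≡ floorHalf (+ (k + i) - + Δ)) ⊎ (+ x ≡ ceilHalf (+ (k + i) - + Δ)))
           → Dist (JAdj v k i) A B r)
       × ((r % 2 ≡ 0)
           → ((+ x ≡ floorHalf (+ (k + i))) ⊎ (+ x ≡ ceilHalf (+ (k + i))))
           → Dist (JAdj v k i) A B r)
lemma5p2 v k i i<k _ 2k≤v not-[2k,0] girth A B =
    (λ r-odd x≈ → let lo , hi = shifted-half-bounds Δ≤k+i x≈ in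
                  dist-when-odd A r r-odd Δ+i<k k≤rΔ+i r′Δ+i<k lo hi)
  , (λ r-even x≈ → let lo , hi = half-bounds (k + i) x≈ in
                   dist-when-even A r r-even k≤rΔ+i r′Δ+i<k lo hi)
  where
  Δ = v ∸ 2 * k + 2 * i
  r = ceilDiv (k ∸ i) Δ
  0<Δ = 0<v∸2k+2i v k i 2k≤v not-[2k,0]
  open JohnsonGraph v k i Δ (trans (xy∙z≈xz∙y (v ∸ 2 * k) (2 * i) (2 * k)) (cong (_+ 2 * i) (m∸n+n≡m 2k≤v)))
                            (m≤n+m (2 * i) (v ∸ 2 * k)) 0<Δ i<k
  open Towards B
  Δ+i<k : Δ + i < k
  Δ+i<k = girth-4⇒Δ+i<k girth A
  Δ≤k+i : Δ ≤ k + i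
  Δ≤k+i = ≤-trans (m≤m+n Δ i) (≤-trans (<⇒≤ Δ+i<k) (m≤m+n k i))
  k∸i+i≡k : k ∸ i + i ≡ k
  k∸i+i≡k = m∸n+n≡m (<⇒≤ i<k)
  k≤rΔ+i : k ≤ r * Δ + i
  k≤rΔ+i = subst (_≤ r * Δ + i) k∸i+i≡k (+-monoˡ-≤ i (ceilDiv-lower (k ∸ i) Δ 0<Δ))
  r′Δ+i<k : ∀ {r′} → r ≡ suc r′ → r′ * Δ + i < k
  r′Δ+i<k {r′} r≡ = subst (r′ * Δ + i <_) k∸i+i≡k (+-monoˡ-< i (ceilDiv-upper (k ∸ i) Δ r≡))
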